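{- For all integers $n\geq 0$, $ac(n)=ac_1(n+1)$.
   Context: A composition of $n$ of length $s$ is a sequence $\sigma=(\sigma_1,\ldots,\sigma_s)$ of positive integers with $\sum_i\sigma_i=n$; the empty composition is the unique composition of $0$, of length $0$. A composition is anti-palindromic if $\sigma_i\neq\sigma_{s-i+1}$ for all $i$ with $i\neq\frac{s+1}{2}$ (the empty composition is vacuously anti-palindromic). $ac(n)$ is the number of anti-palindromic compositions of $n$ and $ac_1(n)$ is the number of anti-palindromic compositions of $n$ of odd length. -}

module Defs where

open import Data.Nat using (ℕ; zero; suc; _∸_; _%_)
open import Data.Nat.Properties using (_≟_)
open import Data.List using (List; []; _∷_; length; reverse; map; concatMap; filter; upTo; lookup)
open import Data.List.Properties using (length-reverse)
open import Data.Fin using (Fin; toℕ; cast)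
open import Data.Fin.Properties using (all?)
open import Relation.Binary.PropositionalEquality using (_≡_; sym)
open import Relation.Nullary using (¬_; Dec)
open import Relation.Nullary.Decidable using (_→-dec_; ¬?)
open import Relation.Unary using (Pred; Decidable)
open import Level using (0ℓ)

-- comps k n : all compositions of n (lists of positive integers summing to n),
-- computed with fuel k (k ≥ n suffices; we use k = n).
comps : ℕ → ℕ → List (List ℕ)
comps zero    zero    = [] ∷ []
comps zero    (suc n) = []
comps (suc k) zero    = [] ∷ []
comps (suc k) (suc n) =
  concatMap (λ i → map (λ c → suc i ∷ c) (comps k (n ∸ i))) (upTo (suc n))

compositions : ℕ → List (List ℕ)
compositions n = comps n n

revAt : (σ : List ℕ) → Fin (length σ) → ℕ
revAt σ i = lookup (reverse σ) (cast (sym (length-reverse σ)) i)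

-- Anti-palindromic: σ_i ≠ σ_{s-i+1} for every i except the middle position.
-- 0-based: for all i < s with i ≠ s-1-i, σ[i] ≠ σ[s-1-i].
AntiPalindromic : List ℕ → Set
AntiPalindromic σ =
  (i : Fin (length σ)) → ¬ (toℕ i ≡ length σ ∸ 1 ∸ toℕ i) → ¬ (lookup σ i ≡ revAt σ i)

antiPalindromic? : Decidable AntiPalindromic
antiPalindromic? σ = all? (λ i → ¬? (toℕ i ≟ length σ ∸ 1 ∸ toℕ i) →-dec ¬? (lookup σ i ≟ revAt σ i))

OddLength : List ℕ → Set
OddLength σ = length σ % 2 ≡ 1

oddLength? : Decidable OddLength
oddLength? σ = length σ % 2 ≟ 1

ac : ℕ → ℕ
ac n = length (filter antiPalindromic? (compositions n))

ac₁ : ℕ → ℕ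
ac₁ n = length (filter oddLength? (filter antiPalindromic? (compositions n)))

{-# OPTIONS --safe #-}
-- Peeling off outer pairs (σ₁, σₛ), an anti-palindromic composition is a nest of pairs of
-- distinct parts around a centre that is either empty or a single part. Growing the centre,
-- [] ↦ [1] and [c] ↦ [1 + c], changes neither the pairs nor positivity, adds 1 to the sum and
-- makes the length odd; shrinking the centre undoes it on compositions of odd length. So growing
-- is a bijection from the anti-palindromic compositions of n onto those of n + 1 of odd length.
module Submission where

open import Defs
open import Data.Nat using (ℕ; zero; suc; _+_; _∸_; _≤_; _<_; s≤s; s≤s⁻¹; z<s; s<s; _%_)
open import Data.Nat.Properties
  using (+-comm; +-assoc; +-suc; +-identityʳ; +-∸-assoc; m∸n≤m; m≤m+n; m+n∸m≡n; m+[n∸m]≡n;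
         ≤-refl; ≤-trans; m<n⇒m<1+n; <-cmp; <⇒≱; suc-injective)
open import Data.Nat.DivMod using (%-remove-+ˡ)
open import Data.Nat.Divisibility using (∣-refl)
open import Data.List using (List; []; _∷_; [_]; _++_; _∷ʳ_; length; reverse; lookup; map; filter; concatMap; upTo)
open import Data.List.Properties using (length-reverse; length-++; reverse-++; unfold-reverse; length-map; ∷-injective; ∷ʳ-injective)
open import Data.Nat.ListAction using (sum)
open import Data.Nat.ListAction.Properties using (sum-++)
open import Data.List.Relation.Unary.All using (All; []; _∷_; universal)
import Data.List.Relation.Unary.All.Properties as All
import Data.List.Relation.Unary.AllPairs as AllPairs
open import Data.List.Relation.Unary.AllPairs using ([]; _∷_)
import Data.List.Relation.Unary.AllPairs.Properties as AllPairs
open import Data.List.Relation.Unary.Any using (here)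
open import Data.List.Relation.Unary.Unique.Propositional using (Unique)
import Data.List.Relation.Unary.Unique.Propositional.Properties as Unique
open import Data.List.Relation.Binary.Disjoint.Propositional using (Disjoint)
open import Data.List.Membership.Propositional using (_∈_; find; lose)
open import Data.List.Membership.Propositional.Properties
  using (∈-concatMap⁺; ∈-concatMap⁻; ∈-map⁺; ∈-map⁻; ∈-upTo⁺; ∈-upTo⁻; ∈-filter⁺; ∈-filter⁻)
open import Data.List.Membership.Propositional.Properties.WithK using (unique∧set⇒bag)
open import Data.List.Relation.Binary.BagAndSetEquality using (∼bag⇒↭)
open import Data.List.Relation.Binary.Permutation.Propositional.Properties using (↭-length)
open import Data.Fin using (Fin; toℕ; fromℕ<)
open import Data.Fin.Properties using (toℕ-cast; toℕ-fromℕ<; toℕ<n)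
open import Data.Product using (_×_; _,_; proj₁; proj₂)
open import Data.Product.Function.NonDependent.Propositional using (_×-⇔_)
open import Function using (_∘_; const; _⇔_; mk⇔; Equivalence)
import Function.Properties.Equivalence as ⇔
open import Function.Related.Propositional using (module EquationalReasoning)
open import Relation.Binary.Definitions using (tri<; tri≈; tri>)
open import Relation.Binary.PropositionalEquality using (_≡_; _≢_; refl; sym; trans; cong; subst; module ≡-Reasoning)

nth : List ℕ → ℕ → ℕ
nth []       _       = 0
nth (x ∷ xs) zero    = x
nth (x ∷ xs) (suc k) = nth xs k

lookup≡nth : ∀ σ (i : Fin (length σ)) → lookup σ i ≡ nth σ (toℕ i)
lookup≡nth (x ∷ σ) Fin.zero    = refl
lookup≡nth (x ∷ σ) (Fin.suc i) = lookup≡nth σ i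

revAt≡nth-reverse : ∀ σ (i : Fin (length σ)) → revAt σ i ≡ nth (reverse σ) (toℕ i)
revAt≡nth-reverse σ i = trans (lookup≡nth (reverse σ) _) (cong (nth (reverse σ)) (toℕ-cast _ i))

nth-++ˡ : ∀ (xs ys : List ℕ) {k} → k < length xs → nth (xs ++ ys) k ≡ nth xs k
nth-++ˡ (x ∷ xs) ys {zero}  _         = refl
nth-++ˡ (x ∷ xs) ys {suc k} (s<s k<n) = nth-++ˡ xs ys k<n

nth-∷ʳ-length : ∀ (xs : List ℕ) y → nth (xs ∷ʳ y) (length xs) ≡ y
nth-∷ʳ-length []       y = refl
nth-∷ʳ-length (x ∷ xs) y = nth-∷ʳ-length xs y

AntiPalindromicOfLength : ℕ → List ℕ → Set
AntiPalindromicOfLength n σ =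
  ∀ k → k < n → k ≢ n ∸ 1 ∸ k → nth σ k ≢ nth (reverse σ) k

antiPalindromic⇔OfLength : ∀ σ → AntiPalindromic σ ⇔ AntiPalindromicOfLength (length σ) σ
antiPalindromic⇔OfLength σ = mk⇔ to from
  where
  Mirrored : ℕ → Set
  Mirrored k = k ≢ length σ ∸ 1 ∸ k → nth σ k ≢ nth (reverse σ) k

  atFin : AntiPalindromic σ → (i : Fin (length σ)) → Mirrored (toℕ i)
  atFin ap i c eq = ap i c (trans (lookup≡nth σ i) (trans eq (sym (revAt≡nth-reverse σ i))))

  to : AntiPalindromic σ → AntiPalindromicOfLength (length σ) σ
  to ap k k<n = subst Mirrored (toℕ-fromℕ< k<n) (atFin ap (fromℕ< k<n))

  from : AntiPalindromicOfLength (length σ) σ → AntiPalindromic σ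
  from ap i c eq = ap (toℕ i) (toℕ<n i) c (trans (sym (lookup≡nth σ i)) (trans eq (revAt≡nth-reverse σ i)))

length-outer : ∀ x (m : List ℕ) y → length (x ∷ m ∷ʳ y) ≡ 2 + length m
length-outer x m y = cong suc (trans (length-++ m) (+-comm (length m) 1))

reverse-outer : ∀ x (m : List ℕ) y → reverse (x ∷ m ∷ʳ y) ≡ y ∷ reverse m ∷ʳ x
reverse-outer x m y = trans (unfold-reverse x (m ∷ʳ y)) (cong (_∷ʳ x) (reverse-++ m [ y ]))

m∸n≡1+[m∸1∸n] : ∀ {m n} → n < m → m ∸ n ≡ suc (m ∸ 1 ∸ n)
m∸n≡1+[m∸1∸n] {suc m} (s≤s n≤m) = +-∸-assoc 1 n≤m

module _ (x : ℕ) (m : List ℕ) (y : ℕ) where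
  private
    L = length m

    nth-reverse-inner : ∀ {j} → j < L → nth (reverse (x ∷ m ∷ʳ y)) (suc j) ≡ nth (reverse m) j
    nth-reverse-inner {j} j<L = trans (cong (λ ρ → nth ρ (suc j)) (reverse-outer x m y))
      (nth-++ˡ (reverse m) [ x ] (subst (j <_) (sym (length-reverse m)) j<L))

    nth-reverse-last : nth (reverse (x ∷ m ∷ʳ y)) (suc L) ≡ x
    nth-reverse-last = trans (cong (λ ρ → nth ρ (suc L)) (reverse-outer x m y))
      (subst (λ n → nth (reverse m ∷ʳ x) n ≡ x) (length-reverse m) (nth-∷ʳ-length (reverse m) x))

    -- (2 + L) ∸ 1 ∸ suc j reduces to L ∸ j: position suc j is central in x ∷ m ∷ʳ y iff j is central in m.
    centre-inner : ∀ {j} → j < L → (suc j ≡ L ∸ j) ⇔ (j ≡ L ∸ 1 ∸ j)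
    centre-inner j<L = mk⇔ (λ e → suc-injective (trans e (m∸n≡1+[m∸1∸n] j<L)))
                           (λ e → trans (cong suc e) (sym (m∸n≡1+[m∸1∸n] j<L)))

    nth-reverse-head : nth (reverse (x ∷ m ∷ʳ y)) 0 ≡ y
    nth-reverse-head = cong (λ ρ → nth ρ 0) (reverse-outer x m y)

  antiPalindromicOfLength-outer : AntiPalindromicOfLength (2 + L) (x ∷ m ∷ʳ y) ⇔ (x ≢ y × AntiPalindromicOfLength L m)
  antiPalindromicOfLength-outer = mk⇔ to from
    where
    to : AntiPalindromicOfLength (2 + L) (x ∷ m ∷ʳ y) → x ≢ y × AntiPalindromicOfLength L m
    to ap = (λ x≡y → ap 0 z<s (λ ()) (trans x≡y (sym nth-reverse-head)))
          , λ j j<L c e → ap (suc j) (s<s (m<n⇒m<1+n j<L)) (c ∘ Equivalence.to (centre-inner j<L))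
              (trans (nth-++ˡ m [ y ] j<L) (trans e (sym (nth-reverse-inner j<L))))

    from : x ≢ y × AntiPalindromicOfLength L m → AntiPalindromicOfLength (2 + L) (x ∷ m ∷ʳ y)
    from (x≢y , ap) zero    _ _ e = x≢y (trans e nth-reverse-head)
    from (x≢y , ap) (suc j) (s<s j≤L) c e with <-cmp j L
    ... | tri< j<L _ _ = ap j j<L (c ∘ Equivalence.from (centre-inner j<L))
            (trans (sym (nth-++ˡ m [ y ] j<L)) (trans e (nth-reverse-inner j<L)))
    ... | tri≈ _ refl _ = x≢y (sym (trans (sym (nth-∷ʳ-length m y)) (trans e nth-reverse-last)))
    ... | tri> _ _ L<j = <⇒≱ L<j (s≤s⁻¹ j≤L)

antiPalindromic-[] : AntiPalindromic []
antiPalindromic-[] ()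

antiPalindromic-[_] : ∀ x → AntiPalindromic [ x ]
antiPalindromic-[ x ] Fin.zero centre _ = centre refl

antiPalindromic-outer : ∀ x m y → AntiPalindromic (x ∷ m ∷ʳ y) ⇔ (x ≢ y × AntiPalindromic m)
antiPalindromic-outer x m y = begin
  AntiPalindromic σ                             ∼⟨ antiPalindromic⇔OfLength σ ⟩
  AntiPalindromicOfLength (length σ) σ          ≡⟨ cong (λ n → AntiPalindromicOfLength n σ) (length-outer x m y) ⟩
  AntiPalindromicOfLength (2 + length m) σ      ∼⟨ antiPalindromicOfLength-outer x m y ⟩
  (x ≢ y × AntiPalindromicOfLength (length m) m) ∼⟨ ⇔.refl ×-⇔ ⇔.sym (antiPalindromic⇔OfLength m) ⟩
  (x ≢ y × AntiPalindromic m)                   ∎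
  where
  open EquationalReasoning
  σ = x ∷ m ∷ʳ y

data Ends {A : Set} : List A → Set where
  empty  : Ends []
  single : ∀ x → Ends [ x ]
  outer  : ∀ x m y → Ends m → Ends (x ∷ m ∷ʳ y)

cons-ends : ∀ {A : Set} (x : A) {xs} → Ends xs → Ends (x ∷ xs)
cons-ends x empty           = single x
cons-ends x (single y)      = outer x [] y empty
cons-ends x (outer a m b v) = outer x (a ∷ m) b (cons-ends a v)

ends : ∀ {A : Set} (xs : List A) → Ends xs
ends []       = empty
ends (x ∷ xs) = cons-ends x (ends xs)

∷ʳ≢[] : ∀ {A : Set} (m : List A) y → m ∷ʳ y ≢ []
∷ʳ≢[] []      y ()
∷ʳ≢[] (_ ∷ _) y ()

ends-unique : ∀ {A : Set} {xs ys : List A} (v : Ends xs) (w : Ends ys) (e : xs ≡ ys) → subst Ends e v ≡ w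
ends-unique empty      empty      refl = refl
ends-unique (single _) (single _) refl = refl
ends-unique (single x) (outer _ m y _) e with () ← ∷ʳ≢[] m y (sym (proj₂ (∷-injective e)))
ends-unique (outer _ m y _) (single x) e with () ← ∷ʳ≢[] m y (proj₂ (∷-injective e))
ends-unique (outer x m y v) (outer x′ m′ y′ w) e
  with refl , e′ ← ∷-injective e
  with refl , refl ← ∷ʳ-injective m m′ e′
  with refl ← e
  = cong (outer x m y) (ends-unique v w refl)

-- The junk value [0] ↦ [0] (never the centre of a composition) keeps grow injective on all lists.
growᵉ : ∀ {σ : List ℕ} → Ends σ → List ℕ
growᵉ empty            = [ 1 ]
growᵉ (single zero)    = [ 0 ]
growᵉ (single (suc z)) = [ suc (suc z) ]
growᵉ (outer x m y v)  = x ∷ growᵉ v ∷ʳ y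

grow : List ℕ → List ℕ
grow σ = growᵉ (ends σ)

shrinkᵉ : ∀ {τ : List ℕ} → Ends τ → List ℕ
shrinkᵉ empty                  = []
shrinkᵉ (single zero)          = [ 0 ]
shrinkᵉ (single (suc zero))    = []
shrinkᵉ (single (suc (suc z))) = [ suc z ]
shrinkᵉ (outer x m y v)        = x ∷ shrinkᵉ v ∷ʳ y

shrink : List ℕ → List ℕ
shrink τ = shrinkᵉ (ends τ)

grow-outer : ∀ x m y → grow (x ∷ m ∷ʳ y) ≡ x ∷ grow m ∷ʳ y
grow-outer x m y = cong growᵉ (ends-unique (ends (x ∷ m ∷ʳ y)) (outer x m y (ends m)) refl)

shrink-outer : ∀ x m y → shrink (x ∷ m ∷ʳ y) ≡ x ∷ shrink m ∷ʳ y
shrink-outer x m y = cong shrinkᵉ (ends-unique (ends (x ∷ m ∷ʳ y)) (outer x m y (ends m)) refl)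

shrink-grow : ∀ σ → shrink (grow σ) ≡ σ
shrink-grow σ = go (ends σ)
  where
  go : ∀ {σ : List ℕ} → Ends σ → shrink (grow σ) ≡ σ
  go empty            = refl
  go (single zero)    = refl
  go (single (suc z)) = refl
  go (outer x m y v)  = begin
    shrink (grow (x ∷ m ∷ʳ y))     ≡⟨ cong shrink (grow-outer x m y) ⟩
    shrink (x ∷ grow m ∷ʳ y)       ≡⟨ shrink-outer x (grow m) y ⟩
    x ∷ shrink (grow m) ∷ʳ y       ≡⟨ cong (λ c → x ∷ c ∷ʳ y) (go v) ⟩
    x ∷ m ∷ʳ y                     ∎
    where open ≡-Reasoning

grow-injective : ∀ {σ τ} → grow σ ≡ grow τ → σ ≡ τ
grow-injective {σ} {τ} e = trans (sym (shrink-grow σ)) (trans (cong shrink e) (shrink-grow τ))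

Positive : List ℕ → Set
Positive = All (0 <_)

positive-outer : ∀ x m y → Positive (x ∷ m ∷ʳ y) ⇔ ((0 < x × 0 < y) × Positive m)
positive-outer x m y = mk⇔ to (λ ((px , py) , pm) → px ∷ All.∷ʳ⁺ pm py)
  where
  to : Positive (x ∷ m ∷ʳ y) → (0 < x × 0 < y) × Positive m
  to (px ∷ pmy) = let pm , py = All.∷ʳ⁻ pmy in (px , py) , pm

oddLength-outer : ∀ x m y → OddLength (x ∷ m ∷ʳ y) ⇔ OddLength m
oddLength-outer x m y = mk⇔ (trans (sym same-parity)) (trans same-parity)
  where
  same-parity : length (x ∷ m ∷ʳ y) % 2 ≡ length m % 2
  same-parity = trans (cong (_% 2) (length-outer x m y)) (%-remove-+ˡ (length m) ∣-refl)

sum-outer : ∀ x m y → sum (x ∷ m ∷ʳ y) ≡ x + sum m + y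
sum-outer x m y = begin
  x + sum (m ++ [ y ])   ≡⟨ cong (x +_) (sum-++ m [ y ]) ⟩
  x + (sum m + (y + 0))  ≡⟨ cong (λ z → x + (sum m + z)) (+-identityʳ y) ⟩
  x + (sum m + y)        ≡⟨ sym (+-assoc x (sum m) y) ⟩
  x + sum m + y          ∎
  where open ≡-Reasoning

grow-invariant : ∀ {P : List ℕ → Set} (Q : ℕ → ℕ → Set) →
                 (∀ x m y → P (x ∷ m ∷ʳ y) ⇔ (Q x y × P m)) →
                 P [ 1 ] ⇔ P [] → (∀ x → P (grow [ x ]) ⇔ P [ x ]) →
                 ∀ σ → P (grow σ) ⇔ P σ
grow-invariant {P} Q P-outer P-empty P-single σ = go (ends σ)
  where
  go : ∀ {σ} → Ends σ → P (grow σ) ⇔ P σ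
  go empty           = P-empty
  go (single x)      = P-single x
  go (outer x m y v) = begin
    P (grow (x ∷ m ∷ʳ y))  ≡⟨ cong P (grow-outer x m y) ⟩
    P (x ∷ grow m ∷ʳ y)    ∼⟨ P-outer x (grow m) y ⟩
    (Q x y × P (grow m))   ∼⟨ ⇔.refl ×-⇔ go v ⟩
    (Q x y × P m)          ∼⟨ ⇔.sym (P-outer x m y) ⟩
    P (x ∷ m ∷ʳ y)         ∎
    where open EquationalReasoning

positive-grow : ∀ σ → Positive (grow σ) ⇔ Positive σ
positive-grow = grow-invariant (λ x y → 0 < x × 0 < y) positive-outer
  (mk⇔ (const []) (const (z<s ∷ [])))
  λ { zero    → ⇔.refl
    ; (suc z) → mk⇔ (const (z<s ∷ [])) (const (z<s ∷ [])) }

antiPalindromic-grow : ∀ σ → AntiPalindromic (grow σ) ⇔ AntiPalindromic σ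
antiPalindromic-grow = grow-invariant _≢_ antiPalindromic-outer
  (mk⇔ (const antiPalindromic-[]) (const antiPalindromic-[ 1 ]))
  λ { zero    → ⇔.refl
    ; (suc z) → mk⇔ (const antiPalindromic-[ suc z ]) (const antiPalindromic-[ suc (suc z) ]) }

grow-oddLength : ∀ σ → OddLength (grow σ)
grow-oddLength σ = go (ends σ)
  where
  go : ∀ {σ} → Ends σ → OddLength (grow σ)
  go empty            = refl
  go (single zero)    = refl
  go (single (suc z)) = refl
  go (outer x m y v)  = subst OddLength (sym (grow-outer x m y))
                          (Equivalence.from (oddLength-outer x (grow m) y) (go v))

sum-grow : ∀ {σ} → Positive σ → sum (grow σ) ≡ suc (sum σ)
sum-grow {σ} = go (ends σ)
  where
  go : ∀ {σ} → Ends σ → Positive σ → sum (grow σ) ≡ suc (sum σ)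
  go empty            _         = refl
  go (single zero)    (() ∷ [])
  go (single (suc z)) _         = refl
  go (outer x m y v)  p         = begin
    sum (grow (x ∷ m ∷ʳ y))  ≡⟨ cong sum (grow-outer x m y) ⟩
    sum (x ∷ grow m ∷ʳ y)    ≡⟨ sum-outer x (grow m) y ⟩
    x + sum (grow m) + y     ≡⟨ cong (λ s → x + s + y) (go v (proj₂ (Equivalence.to (positive-outer x m y) p))) ⟩
    x + suc (sum m) + y      ≡⟨ cong (_+ y) (+-suc x (sum m)) ⟩
    suc (x + sum m + y)      ≡⟨ cong suc (sym (sum-outer x m y)) ⟩
    suc (sum (x ∷ m ∷ʳ y))   ∎
    where open ≡-Reasoning

grow-shrink : ∀ {τ} → Positive τ → OddLength τ → grow (shrink τ) ≡ τ
grow-shrink {τ} = go (ends τ)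
  where
  go : ∀ {τ} → Ends τ → Positive τ → OddLength τ → grow (shrink τ) ≡ τ
  go empty                  _         ()
  go (single zero)          (() ∷ []) _
  go (single (suc zero))    _ _ = refl
  go (single (suc (suc z))) _ _ = refl
  go (outer x m y v)        p o = begin
    grow (shrink (x ∷ m ∷ʳ y))  ≡⟨ cong grow (shrink-outer x m y) ⟩
    grow (x ∷ shrink m ∷ʳ y)    ≡⟨ grow-outer x (shrink m) y ⟩
    x ∷ grow (shrink m) ∷ʳ y    ≡⟨ cong (λ c → x ∷ c ∷ʳ y) (go v pm (Equivalence.to (oddLength-outer x m y) o)) ⟩
    x ∷ m ∷ʳ y                  ∎
    where
    open ≡-Reasoning
    pm : Positive m
    pm = proj₂ (Equivalence.to (positive-outer x m y) p)

IsComposition : ℕ → List ℕ → Set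
IsComposition n σ = Positive σ × sum σ ≡ n

∈-comps⁻ : ∀ k n {σ} → σ ∈ comps k n → IsComposition n σ
∈-comps⁻ zero    zero    (here refl) = [] , refl
∈-comps⁻ (suc k) zero    (here refl) = [] , refl
∈-comps⁻ (suc k) (suc n) σ∈
  with i , i∈ , σ∈ᵢ ← find (∈-concatMap⁻ (λ i → map (suc i ∷_) (comps k (n ∸ i))) {xs = upTo (suc n)} σ∈)
  with τ , τ∈ , refl ← ∈-map⁻ (suc i ∷_) σ∈ᵢ
  with pτ , sumτ ← ∈-comps⁻ k (n ∸ i) τ∈
  = z<s ∷ pτ , cong suc (trans (cong (i +_) sumτ) (m+[n∸m]≡n (s≤s⁻¹ (∈-upTo⁻ i∈))))

∈-comps⁺ : ∀ k n {σ} → n ≤ k → IsComposition n σ → σ ∈ comps k n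
∈-comps⁺ zero    zero    {[]}        _         _              = here refl
∈-comps⁺ (suc k) zero    {[]}        _         _              = here refl
∈-comps⁺ k       zero    {zero ∷ _}  _         (() ∷ _ , _)
∈-comps⁺ k       zero    {suc _ ∷ _} _         (_ , ())
∈-comps⁺ k       (suc n) {[]}        _         (_ , ())
∈-comps⁺ (suc k) (suc n) {suc i ∷ τ} (s≤s n≤k) (_ ∷ pτ , sumσ) =
  ∈-concatMap⁺ (λ j → map (suc j ∷_) (comps k (n ∸ j))) {xs = upTo (suc n)}
    (lose (∈-upTo⁺ (s≤s i≤n)) (∈-map⁺ (suc i ∷_) (∈-comps⁺ k (n ∸ i) (≤-trans (m∸n≤m n i) n≤k) (pτ , sumτ))))
  where
  i+sumτ≡n : i + sum τ ≡ n
  i+sumτ≡n = suc-injective sumσ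
  i≤n : i ≤ n
  i≤n = subst (i ≤_) i+sumτ≡n (m≤m+n i (sum τ))
  sumτ : sum τ ≡ n ∸ i
  sumτ = trans (sym (m+n∸m≡n i (sum τ))) (cong (_∸ i) i+sumτ≡n)

concatMap-unique : ∀ {A B : Set} {f : A → List B} {xs} →
                   (∀ x → Unique (f x)) → (∀ {x y} → x ≢ y → Disjoint (f x) (f y)) →
                   Unique xs → Unique (concatMap f xs)
concatMap-unique {xs = xs} f-unique f-disjoint xs-unique =
  Unique.concat⁺ (All.map⁺ (universal f-unique xs)) (AllPairs.map⁺ (AllPairs.map f-disjoint xs-unique))

comps-unique : ∀ k n → Unique (comps k n)
comps-unique zero    zero    = [] ∷ []
comps-unique zero    (suc n) = []
comps-unique (suc k) zero    = [] ∷ []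
comps-unique (suc k) (suc n) =
  concatMap-unique (λ i → Unique.map⁺ (proj₂ ∘ ∷-injective) (comps-unique k (n ∸ i))) heads-differ (Unique.upTo⁺ (suc n))
  where
  heads-differ : ∀ {i j} → i ≢ j → Disjoint (map (suc i ∷_) (comps k (n ∸ i))) (map (suc j ∷_) (comps k (n ∸ j)))
  heads-differ i≢j (σ∈ᵢ , σ∈ⱼ)
    with _ , _ , refl ← ∈-map⁻ (suc _ ∷_) σ∈ᵢ
    with _ , _ , e ← ∈-map⁻ (suc _ ∷_) σ∈ⱼ
    = i≢j (suc-injective (proj₁ (∷-injective e)))

unique-sameElements⇒length≡ : ∀ {A : Set} {xs ys : List A} → Unique xs → Unique ys →
                              (∀ {z} → z ∈ xs ⇔ z ∈ ys) → length xs ≡ length ys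
unique-sameElements⇒length≡ xs-unique ys-unique same = ↭-length (∼bag⇒↭ (unique∧set⇒bag xs-unique ys-unique same))

AC : ℕ → List (List ℕ)
AC n = filter antiPalindromic? (compositions n)

∈-AC : ∀ n {σ} → σ ∈ AC n ⇔ (IsComposition n σ × AntiPalindromic σ)
∈-AC n = mk⇔ (λ σ∈ → let σ∈c , ap = ∈-filter⁻ antiPalindromic? σ∈ in ∈-comps⁻ n n σ∈c , ap)
             (λ (c , ap) → ∈-filter⁺ antiPalindromic? (∈-comps⁺ n n ≤-refl c) ap)

AC-unique : ∀ n → Unique (AC n)
AC-unique n = Unique.filter⁺ antiPalindromic? (comps-unique n n)

∈-map-grow-AC : ∀ n {τ} → τ ∈ map grow (AC n) ⇔ τ ∈ filter oddLength? (AC (suc n))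
∈-map-grow-AC n = mk⇔ to from
  where
  to : ∀ {τ} → τ ∈ map grow (AC n) → τ ∈ filter oddLength? (AC (suc n))
  to τ∈
    with σ , σ∈ , refl ← ∈-map⁻ grow τ∈
    with (pσ , sumσ) , apσ ← Equivalence.to (∈-AC n) σ∈ =
    ∈-filter⁺ oddLength?
      (Equivalence.from (∈-AC (suc n))
        ( (Equivalence.from (positive-grow σ) pσ , trans (sum-grow pσ) (cong suc sumσ))
        , Equivalence.from (antiPalindromic-grow σ) apσ))
      (grow-oddLength σ)

  from : ∀ {τ} → τ ∈ filter oddLength? (AC (suc n)) → τ ∈ map grow (AC n)
  from {τ} τ∈
    with τ∈AC , oddτ ← ∈-filter⁻ oddLength? τ∈
    with (pτ , sumτ) , apτ ← Equivalence.to (∈-AC (suc n)) τ∈AC =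
    subst (_∈ map grow (AC n)) grow-σ≡τ (∈-map⁺ grow (Equivalence.from (∈-AC n) ((pσ , sumσ) , apσ)))
    where
    σ : List ℕ
    σ = shrink τ
    grow-σ≡τ : grow σ ≡ τ
    grow-σ≡τ = grow-shrink pτ oddτ
    pσ : Positive σ
    pσ = Equivalence.to (positive-grow σ) (subst Positive (sym grow-σ≡τ) pτ)
    apσ : AntiPalindromic σ
    apσ = Equivalence.to (antiPalindromic-grow σ) (subst AntiPalindromic (sym grow-σ≡τ) apτ)
    sumσ : sum σ ≡ n
    sumσ = suc-injective (trans (sym (sum-grow pσ)) (trans (cong sum grow-σ≡τ) sumτ))

proposition4 : (n : ℕ) → ac n ≡ ac₁ (suc n)
proposition4 n = begin
  ac n                      ≡⟨ sym (length-map grow (AC n)) ⟩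
  length (map grow (AC n))  ≡⟨ unique-sameElements⇒length≡ grown-unique odd-unique (∈-map-grow-AC n) ⟩
  ac₁ (suc n)               ∎
  where
  open ≡-Reasoning
  grown-unique : Unique (map grow (AC n))
  grown-unique = Unique.map⁺ grow-injective (AC-unique n)
  odd-unique : Unique (filter oddLength? (AC (suc n)))
  odd-unique = Unique.filter⁺ oddLength? (AC-unique (suc n))
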